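{- Let $G$ and $H$ be two $r$-graphs, let $u,v \in V(G)$ and $x,y \in V(H)$ with $\mu_G(u,v) \geq t$ and $\mu_H(x,y) \geq r-t$. Then $G' = (G,u,v) \oplus_t (H,x,y)$ is an $r$-graph and $\lambda(G') = \min\{\lambda(G), \lambda(H)\}$.
   Context: Graphs are finite, may have parallel edges but no loops. $\mu_G(u,v)$ is the number of edges joining $u$ and $v$ in $G$. $\partial_G(X)$ is the set of edges with exactly one end in $X$. The edge-connectivity $\lambda(G)$ is the maximum $k$ with $|\partial_G(X)| \ge k$ for all non-empty proper $X \subset V(G)$. An $r$-graph is an $r$-regular graph $G$ such that $|\partial_G(Y)| \geq r$ for every $Y \subseteq V(G)$ of odd cardinality. For graphs $G,H$ with $u,v \in V(G)$, $x,y \in V(H)$, $\mu_G(u,v) \ge t$ and $\mu_H(x,y) \ge r-t$, the graph $(G,u,v)\oplus_t (H,x,y)$ is obtained from the disjoint union of $G$ and $H$ by deleting exactly $t$ edges joining $u$ and $v$ in $G$ and exactly $r-t$ edges joining $x$ and $y$ in $H$, then identifying $u$ and $x$ into a new vertex $w_{ux}$ and identifying $v$ and $y$ into a new vertex $w_{vy}$. -}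

module Defs where

open import Data.Nat using (ℕ; zero; suc; _+_; _∸_; _≤_; _%_)
open import Data.Fin using (Fin; zero; suc; splitAt; punchIn; punchOut; _≟_)
open import Data.Fin.Subset using (Subset; Side; inside; outside; ∣_∣; Nonempty; ∁)
open import Data.Vec using (lookup)
open import Data.Maybe using (Maybe; just; nothing)
open import Data.Sum using (inj₁; inj₂)
open import Data.Product using (_×_)
open import Data.Bool using (Bool; true; false; if_then_else_; _∧_; _∨_)
open import Relation.Nullary using (¬_; does)
open import Relation.Binary.PropositionalEquality using (_≡_; _≢_)

-- A finite multigraph (parallel edges allowed, no loops) on vertex set Fin n,
-- given by its edge multiplicity function: μ a b = number of edges joining a and b.
Mult : ℕ → Set
Mult n = Fin n → Fin n → ℕ

IsMultigraph : ∀ {n} → Mult n → Set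
IsMultigraph {n} μ = (∀ (a b : Fin n) → μ a b ≡ μ b a) × (∀ (a : Fin n) → μ a a ≡ 0)

sumFin : ∀ {n} → (Fin n → ℕ) → ℕ
sumFin {zero}  f = 0
sumFin {suc n} f = f zero + sumFin (λ i → f (suc i))

degree : ∀ {n} → Mult n → Fin n → ℕ
degree μ a = sumFin (μ a)

inSide : Side → Bool
inSide inside  = true
inSide outside = false

cut : ∀ {n} → Mult n → Subset n → ℕ
cut μ X = sumFin (λ a → sumFin (λ b →
  if inSide (lookup X a) ∧ Data.Bool.not (inSide (lookup X b)) then μ a b else 0))

Regular : ∀ {n} → ℕ → Mult n → Set
Regular r μ = ∀ a → degree μ a ≡ r

IsRGraph : ∀ {n} → ℕ → Mult n → Set
IsRGraph {n} r μ = IsMultigraph μ × Regular r μ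
  × (∀ (Y : Subset n) → ∣ Y ∣ % 2 ≡ 1 → r ≤ cut μ Y)

CutsAtLeast : ∀ {n} → Mult n → ℕ → Set
CutsAtLeast {n} μ k = ∀ (X : Subset n) → Nonempty X → Nonempty (∁ X) → k ≤ cut μ X

IsEdgeConnectivity : ∀ {n} → Mult n → ℕ → Set
IsEdgeConnectivity μ k = CutsAtLeast μ k × (∀ k' → CutsAtLeast μ k' → k' ≤ k)

deleteEdges : ∀ {n} → Mult n → Fin n → Fin n → ℕ → Mult n
deleteEdges μ s s' d a b =
  if (does (a ≟ s) ∧ does (b ≟ s')) ∨ (does (a ≟ s') ∧ does (b ≟ s))
  then μ a b ∸ d else μ a b

liftMult : ∀ {n k} → Mult k → (Fin n → Maybe (Fin k)) → Mult n
liftMult μ f a b with f a | f b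
... | just p | just q = μ p q
... | _      | _      = 0

-- G' has vertices Fin (n + m): the first n are the vertices of G (u playing the role of
-- w_ux, v that of w_vy), the last m are the vertices of H other than x, y (in order).
glueG : ∀ {n} m → Fin (n + m) → Maybe (Fin n)
glueG {n} m a with splitAt n a
... | inj₁ g = just g
... | inj₂ _ = nothing

glueH : ∀ {n m} (u v : Fin n) (x y : Fin (suc (suc m))) → x ≢ y →
        Fin (n + m) → Maybe (Fin (suc (suc m)))
glueH {n} u v x y x≢y a with splitAt n a
... | inj₁ g = if does (g ≟ u) then just x else (if does (g ≟ v) then just y else nothing)
... | inj₂ k = just (punchIn x (punchIn (punchOut x≢y) k))

glue : ∀ {n m} (r t : ℕ) (μG : Mult n) (u v : Fin n)
       (μH : Mult (suc (suc m))) (x y : Fin (suc (suc m))) → x ≢ y → Mult (n + m)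
glue {n} {m} r t μG u v μH x y x≢y a b =
  liftMult (deleteEdges μG u v t) (glueG {n} m) a b
  + liftMult (deleteEdges μH x y (r ∸ t)) (glueH u v x y x≢y) a b

module Submission where

-- For a set S
-- of G′ let S_G and S_H be its traces on G and H (w_ux, w_vy lying in both).  The deleted edges
-- cross exactly when S separates w_ux from w_vy, hence
--   ∂_G′ S + [S separates w_ux, w_vy]·r = ∂_G S_G + ∂_H S_H.
-- Singletons then give r-regularity.  If S is odd, counting shows that S_G or S_H is odd, or that
-- S separates w_ux, w_vy with S_G, S_H of equal parity; when both are even, adding one vertex
-- to an even set separating p from q shows its cut has at least 2μ(p,q) edges, which makes the
-- right-hand side at least 2r.  For λ(G′) ≥ min, the same dichotomies apply to any cut.  For
-- λ(G′) ≤ min, a cut of G extends to one of G′ of the same size by putting H − {x,y} on the side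
-- of u and v when these agree (and symmetrically for H).

open import Defs
open import Data.Bool using (Bool; true; false; if_then_else_; _∧_; _∨_; not; _xor_)
open import Data.Bool.Properties using (not-involutive; not-distribˡ-xor; ∨-comm; ∧-comm)
open import Data.Empty using (⊥-elim)
open import Data.Fin using (Fin; zero; suc; punchIn; punchOut; _≟_; _↑ˡ_; _↑ʳ_; splitAt)
open import Data.Fin.Properties
  using (↑ˡ-injective; ↑ʳ-injective; punchInᵢ≢i; punchIn-injective; punchIn-punchOut; splitAt-↑ˡ; splitAt-↑ʳ)
open import Data.Fin.Subset using (Subset; ∣_∣)
open import Data.Maybe using (Maybe; just; nothing)
open import Data.Nat using (ℕ; zero; suc; _+_; _∸_; _≤_; _⊓_; _%_)
open import Data.Nat.DivMod using ([m+n]%n≡m%n)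
open import Data.Nat.Properties hiding (_≟_)
open import Data.Product using (_×_; _,_; proj₁; proj₂; ∃)
open import Data.Sum using (_⊎_; inj₁; inj₂)
open import Data.Vec using ([]; _∷_; lookup; tabulate)
open import Data.Vec.Functional using (_++_)
open import Data.Vec.Functional.Properties using (lookup-++ˡ; lookup-++ʳ)
open import Data.Vec.Properties using (lookup∘tabulate; lookup-map; []=⇒lookup; lookup⇒[]=)
open import Function using (_∘_; const; case_of_)
open import Relation.Nullary using (does; yes; no)
open import Relation.Nullary.Decidable using (dec-true; dec-false)
open import Relation.Binary.PropositionalEquality
open import Algebra.Properties.CommutativeSemigroup +-commutativeSemigroup using (interchange; x∙yz≈y∙xz)

-- Finite sums

sumFin-cong : ∀ {n} {f g : Fin n → ℕ} → f ≗ g → sumFin f ≡ sumFin g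
sumFin-cong {zero}  f≗g = refl
sumFin-cong {suc n} f≗g = cong₂ _+_ (f≗g zero) (sumFin-cong (f≗g ∘ suc))

sumFin-+ : ∀ {n} (f g : Fin n → ℕ) → sumFin (λ i → f i + g i) ≡ sumFin f + sumFin g
sumFin-+ {zero}  f g = refl
sumFin-+ {suc n} f g = trans (cong (f zero + g zero +_) (sumFin-+ (f ∘ suc) (g ∘ suc)))
                             (interchange (f zero) (g zero) (sumFin (f ∘ suc)) (sumFin (g ∘ suc)))

sumFin-0 : ∀ {n} {f : Fin n → ℕ} → (∀ i → f i ≡ 0) → sumFin f ≡ 0
sumFin-0 {zero}  f≗0 = refl
sumFin-0 {suc n} f≗0 = cong₂ _+_ (f≗0 zero) (sumFin-0 (f≗0 ∘ suc))

sumFin-punchIn : ∀ {n} (f : Fin (suc n) → ℕ) i → sumFin f ≡ f i + sumFin (f ∘ punchIn i)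
sumFin-punchIn         f zero    = refl
sumFin-punchIn {suc n} f (suc i) = trans (cong (f zero +_) (sumFin-punchIn (f ∘ suc) i))
                                         (x∙yz≈y∙xz (f zero) (f (suc i)) _)

sumFin-≥ : ∀ {n} (f : Fin n → ℕ) i → f i ≤ sumFin f
sumFin-≥ {suc n} f i rewrite sumFin-punchIn f i = m≤m+n (f i) _

sumFin-single : ∀ {n} (f : Fin n → ℕ) i → (∀ j → j ≢ i → f j ≡ 0) → sumFin f ≡ f i
sumFin-single {suc n} f i f≡0 = begin
  sumFin f                      ≡⟨ sumFin-punchIn f i ⟩
  f i + sumFin (f ∘ punchIn i)  ≡⟨ cong (f i +_) (sumFin-0 (λ j → f≡0 _ (punchInᵢ≢i i j))) ⟩
  f i + 0                       ≡⟨ +-identityʳ (f i) ⟩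
  f i                           ∎
  where open ≡-Reasoning

sumFin-pair : ∀ {n} (f : Fin n → ℕ) {i j} → i ≢ j → (∀ k → k ≢ i → k ≢ j → f k ≡ 0) →
              sumFin f ≡ f i + f j
sumFin-pair {suc n} f {i} {j} i≢j f≡0 = begin
  sumFin f                       ≡⟨ sumFin-punchIn f i ⟩
  f i + sumFin (f ∘ punchIn i)   ≡⟨ cong (f i +_) (sumFin-single _ j′ rest≡0) ⟩
  f i + f (punchIn i j′)         ≡⟨ cong (λ k → f i + f k) (punchIn-punchOut i≢j) ⟩
  f i + f j                      ∎
  where
  open ≡-Reasoning
  j′ = punchOut i≢j
  rest≡0 : ∀ k → k ≢ j′ → f (punchIn i k) ≡ 0
  rest≡0 k k≢j′ = f≡0 _ (punchInᵢ≢i i k)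
    (λ e → k≢j′ (punchIn-injective i k j′ (trans e (sym (punchIn-punchOut i≢j)))))

sumFin-↑ : ∀ n {m} (f : Fin (n + m) → ℕ) →
           sumFin f ≡ sumFin (λ i → f (i ↑ˡ m)) + sumFin (λ k → f (n ↑ʳ k))
sumFin-↑ zero    f = refl
sumFin-↑ (suc n) f rewrite sumFin-↑ n (f ∘ suc) = sym (+-assoc (f zero) _ _)

sumFin² : ∀ {n} → (Fin n → Fin n → ℕ) → ℕ
sumFin² F = sumFin (λ a → sumFin (F a))

sumFin²-cong : ∀ {n} {F G : Fin n → Fin n → ℕ} → (∀ a b → F a b ≡ G a b) → sumFin² F ≡ sumFin² G
sumFin²-cong F≡G = sumFin-cong (λ a → sumFin-cong (F≡G a))

sumFin²-+ : ∀ {n} (F G : Fin n → Fin n → ℕ) →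
            sumFin² (λ a b → F a b + G a b) ≡ sumFin² F + sumFin² G
sumFin²-+ F G = trans (sumFin-cong (λ a → sumFin-+ (F a) (G a)))
                      (sumFin-+ (λ a → sumFin (F a)) (λ a → sumFin (G a)))

sumFin²-≥ : ∀ {n} (F : Fin n → Fin n → ℕ) a b → F a b ≤ sumFin² F
sumFin²-≥ F a b = ≤-trans (sumFin-≥ (F a) b) (sumFin-≥ (λ a → sumFin (F a)) a)

infixr 7 [_]·_

[_]·_ : Bool → ℕ → ℕ
[ c ]· x = if c then x else 0

[]·-+ : ∀ c x y → [ c ]· (x + y) ≡ [ c ]· x + [ c ]· y
[]·-+ true  x y = refl
[]·-+ false x y = refl

[]·0 : ∀ c → [ c ]· 0 ≡ 0
[]·0 true  = refl
[]·0 false = refl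

[]·-∧ : ∀ p q x → [ p ∧ q ]· x ≡ [ p ]· [ q ]· x
[]·-∧ true  q x = refl
[]·-∧ false q x = refl

[]·-xor : ∀ p q d → [ p ∧ not q ]· d + [ q ∧ not p ]· d ≡ [ p xor q ]· d
[]·-xor true  true  d = refl
[]·-xor true  false d = +-identityʳ d
[]·-xor false true  d = refl
[]·-xor false false d = refl

[]·-comm : ∀ p q x → [ p ]· [ q ]· x ≡ [ q ]· [ p ]· x
[]·-comm true  q     x = refl
[]·-comm false true  x = refl
[]·-comm false false x = refl

[]·-∨-disjoint : ∀ c p q p′ q′ d → p ∧ p′ ≡ false →
                 [ c ]· [ (p ∧ q) ∨ (p′ ∧ q′) ]· d ≡ [ p ]· [ q ]· [ c ]· d + [ p′ ]· [ q′ ]· [ c ]· d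
[]·-∨-disjoint c     true  q     true  q′    d ()
[]·-∨-disjoint true  true  true  false q′    d _ = sym (+-identityʳ d)
[]·-∨-disjoint false true  true  false q′    d _ = refl
[]·-∨-disjoint c     true  false false q′    d _ = []·0 c
[]·-∨-disjoint c     false q     true  q′    d _ = []·-comm c q′ d
[]·-∨-disjoint c     false q     false q′    d _ = []·0 c

sumFin-[]· : ∀ {n} c (f : Fin n → ℕ) → sumFin (λ i → [ c ]· f i) ≡ [ c ]· sumFin f
sumFin-[]· true  f = refl
sumFin-[]· {n} false f = sumFin-0 {n} (λ _ → refl)

is : ∀ {n} → Fin n → Fin n → Bool
is w i = does (i ≟ w)

is-refl : ∀ {n} (w : Fin n) → is w w ≡ true
is-refl w = dec-true (w ≟ w) refl

is-≢ : ∀ {n} {w i : Fin n} → i ≢ w → is w i ≡ false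
is-≢ {w = w} {i} = dec-false (i ≟ w)

is⇒≡ : ∀ {n} {w i : Fin n} → is w i ≡ true → i ≡ w
is⇒≡ {w = w} {i} h with i ≟ w
... | yes i≡w = i≡w

is-injective : ∀ {k l} (f : Fin k → Fin l) → (∀ a b → f a ≡ f b → a ≡ b) →
               ∀ a b → is (f a) (f b) ≡ is a b
is-injective f f-inj a b with b ≟ a
... | yes refl = is-refl (f a)
... | no b≢a   = is-≢ (b≢a ∘ f-inj b a)

is-comm : ∀ {n} (a b : Fin n) → is a b ≡ is b a
is-comm a b with b ≟ a | a ≟ b
... | yes _   | yes _   = refl
... | yes b≡a | no  a≢b = ⊥-elim (a≢b (sym b≡a))
... | no  b≢a | yes a≡b = ⊥-elim (b≢a (sym a≡b))
... | no  _   | no  _   = refl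

is-disjoint : ∀ {n} {u v : Fin n} → u ≢ v → ∀ a → is u a ∧ is v a ≡ false
is-disjoint {u = u} u≢v a with is u a in a≡u
... | true  = is-≢ (λ a≡v → u≢v (trans (sym (is⇒≡ {w = u} {a} a≡u)) a≡v))
... | false = refl

sumFin-is : ∀ {n} (w : Fin n) (f : Fin n → ℕ) → sumFin (λ i → [ is w i ]· f i) ≡ f w
sumFin-is w f = trans (sumFin-single _ w (λ j j≢w → cong ([_]· f j) (is-≢ j≢w)))
                      (cong ([_]· f w) (is-refl w))

sumFin²-is : ∀ {n} (p q : Fin n) (F : Fin n → Fin n → ℕ) →
             sumFin² (λ a b → [ is p a ]· [ is q b ]· F a b) ≡ F p q
sumFin²-is p q F = begin
  sumFin (λ a → sumFin (λ b → [ is p a ]· [ is q b ]· F a b))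
    ≡⟨ sumFin-cong (λ a → sumFin-[]· (is p a) (λ b → [ is q b ]· F a b)) ⟩
  sumFin (λ a → [ is p a ]· sumFin (λ b → [ is q b ]· F a b))
    ≡⟨ sumFin-is p _ ⟩
  sumFin (λ b → [ is q b ]· F p b)
    ≡⟨ sumFin-is q (F p) ⟩
  F p q ∎
  where open ≡-Reasoning

-- Cuts and parities of vertex sets

∂ : ∀ {n} → Mult n → (Fin n → Bool) → ℕ
∂ μ S = sumFin² (λ a b → [ S a ∧ not (S b) ]· μ a b)

count : ∀ {n} → (Fin n → Bool) → ℕ
count S = sumFin (λ i → [ S i ]· 1)

∂-cong : ∀ {n} (μ : Mult n) {S T : Fin n → Bool} → S ≗ T → ∂ μ S ≡ ∂ μ T
∂-cong μ S≗T = sumFin²-cong (λ a b → cong₂ (λ p q → [ p ∧ not q ]· μ a b) (S≗T a) (S≗T b))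

count-cong : ∀ {n} {S T : Fin n → Bool} → S ≗ T → count S ≡ count T
count-cong S≗T = sumFin-cong (cong ([_]· 1) ∘ S≗T)

∂-+ : ∀ {n} (μ ν : Mult n) S → ∂ (λ a b → μ a b + ν a b) S ≡ ∂ μ S + ∂ ν S
∂-+ μ ν S = trans (sumFin²-cong (λ a b → []·-+ (S a ∧ not (S b)) (μ a b) (ν a b)))
                  (sumFin²-+ (λ a b → [ S a ∧ not (S b) ]· μ a b) (λ a b → [ S a ∧ not (S b) ]· ν a b))

∂-const : ∀ {n} (μ : Mult n) c → ∂ μ (const c) ≡ 0
∂-const {n} μ c = sumFin-0 {n} (λ a → sumFin-0 {n} (λ b → c∧¬c·x≡0 c))
  where
  c∧¬c·x≡0 : ∀ {x} c → [ c ∧ not c ]· x ≡ 0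
  c∧¬c·x≡0 true  = refl
  c∧¬c·x≡0 false = refl

∂-is : ∀ {n} (μ : Mult n) w → μ w w ≡ 0 → ∂ μ (is w) ≡ degree μ w
∂-is μ w μww≡0 = begin
  sumFin² (λ a b → [ is w a ∧ not (is w b) ]· μ a b)
    ≡⟨ sumFin²-cong (λ a b → []·-∧ (is w a) (not (is w b)) (μ a b)) ⟩
  sumFin (λ a → sumFin (λ b → [ is w a ]· [ not (is w b) ]· μ a b))
    ≡⟨ sumFin-cong (λ a → sumFin-[]· (is w a) (λ b → [ not (is w b) ]· μ a b)) ⟩
  sumFin (λ a → [ is w a ]· sumFin (λ b → [ not (is w b) ]· μ a b))
    ≡⟨ sumFin-is w _ ⟩
  sumFin (λ b → [ not (is w b) ]· μ w b)
    ≡⟨ sumFin-cong off-w ⟩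
  sumFin (μ w) ∎
  where
  open ≡-Reasoning
  off-w : ∀ b → [ not (is w b) ]· μ w b ≡ μ w b
  off-w b with b ≟ w
  ... | yes refl = sym μww≡0
  ... | no _     = refl

odd : ℕ → Bool
odd zero    = false
odd (suc n) = not (odd n)

odd-+ : ∀ m n → odd (m + n) ≡ odd m xor odd n
odd-+ zero    n = refl
odd-+ (suc m) n = trans (cong not (odd-+ m n)) (not-distribˡ-xor (odd m) (odd n))

%2≡[odd]·1 : ∀ n → n % 2 ≡ [ odd n ]· 1
%2≡[odd]·1 zero          = refl
%2≡[odd]·1 (suc zero)    = refl
%2≡[odd]·1 (suc (suc n)) = begin
  (2 + n) % 2              ≡⟨ cong (_% 2) (+-comm 2 n) ⟩
  (n + 2) % 2              ≡⟨ [m+n]%n≡m%n n 2 ⟩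
  n % 2                    ≡⟨ %2≡[odd]·1 n ⟩
  [ odd n ]· 1             ≡⟨ cong ([_]· 1) (not-involutive (odd n)) ⟨
  [ odd (2 + n) ]· 1       ∎
  where open ≡-Reasoning

odd-[]·1+[]·1 : ∀ p q → odd ([ p ]· 1 + [ q ]· 1) ≡ p xor q
odd-[]·1+[]·1 true  true  = refl
odd-[]·1+[]·1 true  false = refl
odd-[]·1+[]·1 false true  = refl
odd-[]·1+[]·1 false false = refl

member : ∀ {n} → Subset n → Fin n → Bool
member X i = inSide (lookup X i)

inSide-id : ∀ b → inSide b ≡ b
inSide-id true  = refl
inSide-id false = refl

member-tabulate : ∀ {n} (S : Fin n → Bool) → member (tabulate S) ≗ S
member-tabulate S i = trans (inSide-id _) (lookup∘tabulate S i)

∣∣≡count : ∀ {n} (X : Subset n) → ∣ X ∣ ≡ count (member X)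
∣∣≡count []          = refl
∣∣≡count (true ∷ X)  = cong suc (∣∣≡count X)
∣∣≡count (false ∷ X) = ∣∣≡count X

∂-odd-≥ : ∀ {n r} {μ : Mult n} → IsRGraph r μ → ∀ S → odd (count S) ≡ true → r ≤ ∂ μ S
∂-odd-≥ {μ = μ} (_ , _ , odd-cut) S oddS =
  subst (_ ≤_) (∂-cong μ (member-tabulate S)) (odd-cut (tabulate S) ∣X∣%2≡1)
  where
  ∣X∣%2≡1 : ∣ tabulate S ∣ % 2 ≡ 1
  ∣X∣%2≡1 = begin
    ∣ tabulate S ∣ % 2                      ≡⟨ %2≡[odd]·1 ∣ tabulate S ∣ ⟩
    [ odd ∣ tabulate S ∣ ]· 1               ≡⟨ cong (λ c → [ odd c ]· 1) (∣∣≡count (tabulate S)) ⟩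
    [ odd (count (member (tabulate S))) ]· 1 ≡⟨ cong (λ c → [ odd c ]· 1) (count-cong (member-tabulate S)) ⟩
    [ odd (count S) ]· 1                    ≡⟨ cong ([_]· 1) oddS ⟩
    1                                       ∎
    where open ≡-Reasoning

odd-∂-≥⇒IsRGraph : ∀ {n r} {μ : Mult n} → IsMultigraph μ → Regular r μ →
                   (∀ S → odd (count S) ≡ true → r ≤ ∂ μ S) → IsRGraph r μ
odd-∂-≥⇒IsRGraph multigraph regular odd-∂ = multigraph , regular , λ Y ∣Y∣%2≡1 →
  odd-∂ (member Y) (trans (cong odd (sym (∣∣≡count Y)))
                          ([]·1≡1 (trans (sym (%2≡[odd]·1 ∣ Y ∣)) ∣Y∣%2≡1)))
  where
  []·1≡1 : ∀ {b} → [ b ]· 1 ≡ 1 → b ≡ true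
  []·1≡1 {true} _ = refl

CutsAtLeast⇒∂-≥ : ∀ {n k} {μ : Mult n} → CutsAtLeast μ k →
                  ∀ S {i j} → S i ≡ true → S j ≡ false → k ≤ ∂ μ S
CutsAtLeast⇒∂-≥ {μ = μ} cuts S {i} {j} Si Sj =
  subst (_ ≤_) (∂-cong μ (member-tabulate S))
    (cuts (tabulate S) (i , lookup⇒[]= i _ (trans (lookup∘tabulate S i) Si))
                       (j , lookup⇒[]= j _ (trans (lookup-map j not (tabulate S))
                                                  (cong not (trans (lookup∘tabulate S j) Sj)))))

∂-≥⇒CutsAtLeast : ∀ {n k} {μ : Mult n} →
                  (∀ S {i j} → S i ≡ true → S j ≡ false → k ≤ ∂ μ S) → CutsAtLeast μ k
∂-≥⇒CutsAtLeast cuts X (i , i∈X) (j , j∉X) =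
  cuts (member X) (trans (inSide-id _) ([]=⇒lookup i∈X))
       (trans (inSide-id _) (not-injective (trans (sym (lookup-map j not X)) ([]=⇒lookup j∉X))))
  where
  not-injective : ∀ {b} → not b ≡ true → b ≡ false
  not-injective {false} _ = refl

CutsAtLeast⇒≤degree : ∀ {n k} {μ : Mult n} → CutsAtLeast μ k →
                      ∀ {u v} → μ u u ≡ 0 → u ≢ v → k ≤ degree μ u
CutsAtLeast⇒≤degree {μ = μ} cuts {u} {v} μuu≡0 u≢v =
  subst (_ ≤_) (∂-is μ u μuu≡0) (CutsAtLeast⇒∂-≥ cuts (is u) {u} {v} (is-refl u) (is-≢ (u≢v ∘ sym)))

xor≡true⇒≢ : ∀ {p q} → p xor q ≡ true → p ≢ q
xor≡true⇒≢ {true}  {false} _ ()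
xor≡true⇒≢ {false} {true}  _ ()

other-side : ∀ {n} (S : Fin n → Bool) {i j} → S i ≡ true → S j ≡ false → ∀ w → ∃ λ z → S z ≢ S w
other-side S {i} {j} Si Sj w with S w
... | true  = j , λ e → case (trans (sym Sj) e) of λ ()
... | false = i , λ e → case (trans (sym Si) e) of λ ()

CutsAtLeast⇒∂-separating-≥ : ∀ {n k} {μ : Mult n} → CutsAtLeast μ k →
                             ∀ S {i j} → S i ≢ S j → k ≤ ∂ μ S
CutsAtLeast⇒∂-separating-≥ cuts S {i} {j} Si≢Sj with S i in Si | S j in Sj
... | true  | false = CutsAtLeast⇒∂-≥ cuts S Si Sj
... | false | true  = CutsAtLeast⇒∂-≥ cuts S Sj Si
... | true  | true  = ⊥-elim (Si≢Sj refl)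
... | false | false = ⊥-elim (Si≢Sj refl)

insert-pointwise : ∀ (sa sb da db : Bool) x → (da ≡ true → sa ≡ false) → (db ≡ true → sb ≡ false) →
                   (da ≡ true → db ≡ true → x ≡ 0) →
                   [ (sa ∨ da) ∧ not (sb ∨ db) ]· x + ([ sa ]· [ db ]· x + [ da ]· [ sb ]· x)
                     ≡ [ sa ∧ not sb ]· x + [ da ]· x
insert-pointwise true  _     true  _     x a∉ _  _    with () ← a∉ refl
insert-pointwise _     true  _     true  x _  b∉ _    with () ← b∉ refl
insert-pointwise false false true  true  x _  _  loop rewrite loop refl refl = refl
insert-pointwise true  false false true  x _  _  _    = refl
insert-pointwise true  true  false false x _  _  _    = refl
insert-pointwise true  false false false x _  _  _    = refl
insert-pointwise false true  true  false x _  _  _    = refl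
insert-pointwise false false true  false x _  _  _    = +-identityʳ x
insert-pointwise false false false true  x _  _  _    = refl
insert-pointwise false _     false false x _  _  _    = refl

∂-insert : ∀ {n} (μ : Mult n) S w → μ w w ≡ 0 → S w ≡ false →
           ∂ μ (λ i → S i ∨ is w i)
             + (sumFin² (λ a b → [ S a ]· [ is w b ]· μ a b) + sumFin² (λ a b → [ is w a ]· [ S b ]· μ a b))
           ≡ ∂ μ S + degree μ w
∂-insert μ S w μww≡0 w∉S = begin
  ∂ μ S⁺ + (sumFin² into-w + sumFin² out-of-w)
    ≡⟨ cong (∂ μ S⁺ +_) (sumFin²-+ into-w out-of-w) ⟨
  ∂ μ S⁺ + sumFin² (λ a b → into-w a b + out-of-w a b)
    ≡⟨ sumFin²-+ (λ a b → [ S⁺ a ∧ not (S⁺ b) ]· μ a b) _ ⟨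
  sumFin² (λ a b → [ S⁺ a ∧ not (S⁺ b) ]· μ a b + (into-w a b + out-of-w a b))
    ≡⟨ sumFin²-cong (λ a b → insert-pointwise (S a) (S b) (is w a) (is w b) (μ a b)
                               (off-S a) (off-S b)
                               (λ a≡w b≡w → trans (cong₂ μ (is⇒≡ a≡w) (is⇒≡ b≡w)) μww≡0)) ⟩
  sumFin² (λ a b → [ S a ∧ not (S b) ]· μ a b + [ is w a ]· μ a b)
    ≡⟨ sumFin²-+ (λ a b → [ S a ∧ not (S b) ]· μ a b) (λ a b → [ is w a ]· μ a b) ⟩
  ∂ μ S + sumFin (λ a → sumFin (λ b → [ is w a ]· μ a b))
    ≡⟨ cong (∂ μ S +_) (trans (sumFin-cong (λ a → sumFin-[]· (is w a) (μ a))) (sumFin-is w (degree μ))) ⟩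
  ∂ μ S + degree μ w ∎
  where
  open ≡-Reasoning
  S⁺ = λ i → S i ∨ is w i
  into-w = λ a b → [ S a ]· [ is w b ]· μ a b
  out-of-w = λ a b → [ is w a ]· [ S b ]· μ a b
  off-S : ∀ a → is w a ≡ true → S a ≡ false
  off-S a a≡w = trans (cong S (is⇒≡ a≡w)) w∉S

count-insert : ∀ {n} S (w : Fin n) → S w ≡ false → count (λ i → S i ∨ is w i) ≡ count S + 1
count-insert S w w∉S = begin
  sumFin (λ i → [ S i ∨ is w i ]· 1)           ≡⟨ sumFin-cong (λ i → disjoint (S i) (is w i) (off-S i)) ⟩
  sumFin (λ i → [ S i ]· 1 + [ is w i ]· 1)    ≡⟨ sumFin-+ (λ i → [ S i ]· 1) (λ i → [ is w i ]· 1) ⟩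
  count S + sumFin (λ i → [ is w i ]· 1)       ≡⟨ cong (count S +_) (sumFin-is w (const 1)) ⟩
  count S + 1                                  ∎
  where
  open ≡-Reasoning
  off-S : ∀ a → is w a ≡ true → S a ≡ false
  off-S a a≡w = trans (cong S (is⇒≡ a≡w)) w∉S
  disjoint : ∀ p q → (q ≡ true → p ≡ false) → [ p ∨ q ]· 1 ≡ [ p ]· 1 + [ q ]· 1
  disjoint true  true  q⇒¬p with () ← q⇒¬p refl
  disjoint true  false _    = refl
  disjoint false q     _    = refl

-- Adding w to S gives an odd set; its cut is ∂ S + r minus twice the edges between w and S.
∂-even-≥ : ∀ {n r} {μ : Mult n} → IsRGraph r μ →
           ∀ S {z w} → S z ≡ true → S w ≡ false → odd (count S) ≡ false → μ w z + μ w z ≤ ∂ μ S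
∂-even-≥ {r = r} {μ} rg@((μ-sym , loopless) , regular , _) S {z} {w} z∈S w∉S evenS =
  +-cancelˡ-≤ r _ _ (begin
    r + (μ w z + μ w z)
      ≤⟨ +-mono-≤ (∂-odd-≥ rg S⁺ oddS⁺) (+-mono-≤ z→w w→z) ⟩
    ∂ μ S⁺ + (sumFin² into-w + sumFin² out-of-w)
      ≡⟨ ∂-insert μ S w (loopless w) w∉S ⟩
    ∂ μ S + degree μ w
      ≡⟨ cong (∂ μ S +_) (regular w) ⟩
    ∂ μ S + r
      ≡⟨ +-comm (∂ μ S) r ⟩
    r + ∂ μ S ∎)
  where
  open ≤-Reasoning
  S⁺ = λ i → S i ∨ is w i
  into-w = λ a b → [ S a ]· [ is w b ]· μ a b
  out-of-w = λ a b → [ is w a ]· [ S b ]· μ a b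
  oddS⁺ : odd (count S⁺) ≡ true
  oddS⁺ = trans (cong odd (count-insert S w w∉S))
                (trans (odd-+ (count S) 1) (cong (_xor true) evenS))
  z→w : μ w z ≤ sumFin² into-w
  z→w = subst (_≤ sumFin² into-w)
              (trans (cong₂ (λ p q → [ p ]· [ q ]· μ z w) z∈S (is-refl w)) (μ-sym z w))
              (sumFin²-≥ into-w z w)
  w→z : μ w z ≤ sumFin² out-of-w
  w→z = subst (_≤ sumFin² out-of-w)
              (cong₂ (λ p q → [ p ]· [ q ]· μ w z) (is-refl w) z∈S)
              (sumFin²-≥ out-of-w w z)

-- Deleting and transporting edges

deleteEdges-pointwise : ∀ {n} (μ : Mult n) u v d a b →
                        ((is u a ∧ is v b) ∨ (is v a ∧ is u b) ≡ true → d ≤ μ a b) →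
                        μ a b ≡ deleteEdges μ u v d a b + [ (is u a ∧ is v b) ∨ (is v a ∧ is u b) ]· d
deleteEdges-pointwise μ u v d a b d≤μab with (is u a ∧ is v b) ∨ (is v a ∧ is u b)
... | true  = sym (m∸n+n≡m (d≤μab refl))
... | false = sym (+-identityʳ (μ a b))

∂-deleteEdges : ∀ {n} (μ : Mult n) {u v} d S → (∀ a b → μ a b ≡ μ b a) → u ≢ v → d ≤ μ u v →
                ∂ μ S ≡ ∂ (deleteEdges μ u v d) S + [ S u xor S v ]· d
∂-deleteEdges μ {u} {v} d S μ-sym u≢v d≤μuv = begin
  ∂ μ S
    ≡⟨ sumFin²-cong (λ a b → trans (cong ([ C a b ]·_) (deleteEdges-pointwise μ u v d a b (d≤ a b)))
                                   ([]·-+ (C a b) _ _)) ⟩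
  sumFin² (λ a b → [ C a b ]· deleteEdges μ u v d a b + deleted a b)
    ≡⟨ sumFin²-+ (λ a b → [ C a b ]· deleteEdges μ u v d a b) deleted ⟩
  ∂ (deleteEdges μ u v d) S + sumFin² deleted
    ≡⟨ cong (∂ (deleteEdges μ u v d) S +_) (begin
      sumFin² deleted
        ≡⟨ sumFin²-cong (λ a b → []·-∨-disjoint (C a b) (is u a) (is v b) (is v a) (is u b) d (is-disjoint u≢v a)) ⟩
      sumFin² (λ a b → [ is u a ]· [ is v b ]· [ C a b ]· d + [ is v a ]· [ is u b ]· [ C a b ]· d)
        ≡⟨ sumFin²-+ (λ a b → [ is u a ]· [ is v b ]· [ C a b ]· d) _ ⟩
      sumFin² (λ a b → [ is u a ]· [ is v b ]· [ C a b ]· d)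
        + sumFin² (λ a b → [ is v a ]· [ is u b ]· [ C a b ]· d)
        ≡⟨ cong₂ _+_ (sumFin²-is u v (λ a b → [ C a b ]· d)) (sumFin²-is v u (λ a b → [ C a b ]· d)) ⟩
      [ C u v ]· d + [ C v u ]· d
        ≡⟨ []·-xor (S u) (S v) d ⟩
      [ S u xor S v ]· d ∎) ⟩
  ∂ (deleteEdges μ u v d) S + [ S u xor S v ]· d ∎
  where
  open ≡-Reasoning
  C : _ → _ → Bool
  C a b = S a ∧ not (S b)
  deleted = λ a b → [ C a b ]· [ (is u a ∧ is v b) ∨ (is v a ∧ is u b) ]· d
  d≤μvu : d ≤ μ v u
  d≤μvu = subst (d ≤_) (μ-sym u v) d≤μuv
  at : ∀ {a b p q} → a ≡ p → b ≡ q → d ≤ μ p q → d ≤ μ a b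
  at refl refl d≤μpq = d≤μpq
  d≤ : ∀ a b → (is u a ∧ is v b) ∨ (is v a ∧ is u b) ≡ true → d ≤ μ a b
  d≤ a b uv with is u a in a≡u | is v b in b≡v | is v a in a≡v | is u b in b≡u
  ... | true  | true  | _    | _    = at (is⇒≡ {w = u} {a} a≡u) (is⇒≡ {w = v} {b} b≡v) d≤μuv
  ... | true  | false | true | true = at (is⇒≡ {w = v} {a} a≡v) (is⇒≡ {w = u} {b} b≡u) d≤μvu
  ... | false | _     | true | true = at (is⇒≡ {w = v} {a} a≡v) (is⇒≡ {w = u} {b} b≡u) d≤μvu

deleteEdges-sym : ∀ {n} (μ : Mult n) u v d → (∀ a b → μ a b ≡ μ b a) →
                  ∀ a b → deleteEdges μ u v d a b ≡ deleteEdges μ u v d b a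
deleteEdges-sym μ u v d μ-sym a b
  rewrite ∨-comm (is u a ∧ is v b) (is v a ∧ is u b) | ∧-comm (is v a) (is u b) | ∧-comm (is u a) (is v b)
        | μ-sym a b = refl

deleteEdges-loopless : ∀ {n} (μ : Mult n) u v d → (∀ a → μ a a ≡ 0) → ∀ a → deleteEdges μ u v d a a ≡ 0
deleteEdges-loopless μ u v d loopless a rewrite loopless a with (is u a ∧ is v a) ∨ (is v a ∧ is u a)
... | true  = 0∸n≡0 d
... | false = refl

liftMult-just : ∀ {n k} (μ : Mult k) (f : Fin n → Maybe (Fin k)) {a b p q} →
                f a ≡ just p → f b ≡ just q → liftMult μ f a b ≡ μ p q
liftMult-just μ f {a} {b} fa fb rewrite fa | fb = refl

liftMult-nothingˡ : ∀ {n k} (μ : Mult k) (f : Fin n → Maybe (Fin k)) {a} b → f a ≡ nothing → liftMult μ f a b ≡ 0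
liftMult-nothingˡ μ f {a} b fa rewrite fa = refl

liftMult-nothingʳ : ∀ {n k} (μ : Mult k) (f : Fin n → Maybe (Fin k)) a {b} → f b ≡ nothing → liftMult μ f a b ≡ 0
liftMult-nothingʳ μ f a {b} fb with f a
... | just _ rewrite fb = refl
... | nothing = refl

liftMult-sym : ∀ {n k} (μ : Mult k) (f : Fin n → Maybe (Fin k)) → (∀ p q → μ p q ≡ μ q p) →
               ∀ a b → liftMult μ f a b ≡ liftMult μ f b a
liftMult-sym μ f μ-sym a b with f a | f b
... | just p  | just q  = μ-sym p q
... | just _  | nothing = refl
... | nothing | just _  = refl
... | nothing | nothing = refl

liftMult-loopless : ∀ {n k} (μ : Mult k) (f : Fin n → Maybe (Fin k)) → (∀ p → μ p p ≡ 0) →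
                    ∀ a → liftMult μ f a a ≡ 0
liftMult-loopless μ f loopless a with f a
... | just p  = loopless p
... | nothing = refl

∂-liftMult : ∀ {n k} (μ : Mult k) (f : Fin n → Maybe (Fin k)) (ι : Fin k → Fin n) →
             (∀ p → f (ι p) ≡ just p) →
             (∀ F → (∀ a → f a ≡ nothing → F a ≡ 0) → sumFin F ≡ sumFin (F ∘ ι)) →
             ∀ S → ∂ (liftMult μ f) S ≡ ∂ μ (S ∘ ι)
∂-liftMult μ f ι f∘ι reindex S = begin
  sumFin (λ a → sumFin (λ b → [ C a b ]· liftMult μ f a b))
    ≡⟨ reindex _ (λ a fa → sumFin-0 (λ b → trans (cong ([ C a b ]·_) (liftMult-nothingˡ μ f b fa)) ([]·0 _))) ⟩
  sumFin (λ p → sumFin (λ b → [ C (ι p) b ]· liftMult μ f (ι p) b))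
    ≡⟨ sumFin-cong (λ p → reindex _ (λ b fb →
         trans (cong ([ C (ι p) b ]·_) (liftMult-nothingʳ μ f (ι p) fb)) ([]·0 _))) ⟩
  sumFin (λ p → sumFin (λ q → [ C (ι p) (ι q) ]· liftMult μ f (ι p) (ι q)))
    ≡⟨ sumFin²-cong (λ p q → cong ([ C (ι p) (ι q) ]·_) (liftMult-just μ f (f∘ι p) (f∘ι q))) ⟩
  ∂ μ (S ∘ ι) ∎
  where
  open ≡-Reasoning
  C : _ → _ → Bool
  C a b = S a ∧ not (S b)

-- Gluing

pinned : ∀ {n} → Fin n → Fin n → Bool → Bool → Fin n → Bool
pinned p q true  true  = const true
pinned p q true  false = is p
pinned p q false true  = is q
pinned p q false false = const false

pinned-first : ∀ {n} {p q : Fin n} b₁ b₂ → p ≢ q → pinned p q b₁ b₂ p ≡ b₁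
pinned-first {p = p} true  true  _   = refl
pinned-first {p = p} true  false _   = is-refl p
pinned-first         false true  p≢q = is-≢ p≢q
pinned-first         false false _   = refl

pinned-second : ∀ {n} {p q : Fin n} b₁ b₂ → p ≢ q → pinned p q b₁ b₂ q ≡ b₂
pinned-second         true  true  _   = refl
pinned-second         true  false p≢q = is-≢ (p≢q ∘ sym)
pinned-second {q = q} false true  _   = is-refl q
pinned-second         false false _   = refl

pinned-other : ∀ {n} {p q h : Fin n} b₁ b₂ → h ≢ p → h ≢ q → pinned p q b₁ b₂ h ≡ b₁ ∧ b₂
pinned-other true  true  _   _   = refl
pinned-other true  false h≢p _   = is-≢ h≢p
pinned-other false true  _   h≢q = is-≢ h≢q
pinned-other false false _   _   = refl

∂-pinned : ∀ {n r} (μ : Mult n) → (∀ a → μ a a ≡ 0) → Regular r μ →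
           ∀ p q b₁ b₂ → ∂ μ (pinned p q b₁ b₂) ≡ [ b₁ xor b₂ ]· r
∂-pinned μ loopless regular p q true  true  = ∂-const μ true
∂-pinned μ loopless regular p q true  false = trans (∂-is μ p (loopless p)) (regular p)
∂-pinned μ loopless regular p q false true  = trans (∂-is μ q (loopless q)) (regular q)
∂-pinned μ loopless regular p q false false = ∂-const μ false

data SplitView (n m : ℕ) : Fin (n + m) → Set where
  left  : (i : Fin n) → SplitView n m (i ↑ˡ m)
  right : (k : Fin m) → SplitView n m (n ↑ʳ k)

splitView : ∀ n {m} (i : Fin (n + m)) → SplitView n m i
splitView zero    i       = right i
splitView (suc n) zero    = left zero
splitView (suc n) (suc i) with splitView n i
... | left j  = left (suc j)
... | right k = right k

↑ˡ≢↑ʳ : ∀ n {m} (i : Fin n) (k : Fin m) → i ↑ˡ m ≢ n ↑ʳ k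
↑ˡ≢↑ʳ n {m} i k e with () ← trans (sym (splitAt-↑ˡ n i m)) (trans (cong (splitAt n) e) (splitAt-↑ʳ n m k))

⊓-≤-of-crossing : ∀ {a b r c cG cH} → c + r ≡ cG + cH → a ≤ cG → b ≤ cH → a ≤ r →
                  r ≤ cG ⊎ r ≤ cH ⊎ r + r ≤ cG + cH → a ⊓ b ≤ c
⊓-≤-of-crossing {a} {b} {r} {c} {cG} {cH} eq a≤cG b≤cH a≤r (inj₁ r≤cG) =
  ≤-trans (m⊓n≤n a b) (≤-trans b≤cH (+-cancelˡ-≤ r cH c (begin
    r + cH  ≤⟨ +-monoˡ-≤ cH r≤cG ⟩
    cG + cH ≡⟨ eq ⟨
    c + r   ≡⟨ +-comm c r ⟩
    r + c   ∎)))
  where open ≤-Reasoning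
⊓-≤-of-crossing {a} {b} {r} {c} {cG} {cH} eq a≤cG b≤cH a≤r (inj₂ (inj₁ r≤cH)) =
  ≤-trans (m⊓n≤m a b) (≤-trans a≤cG (+-cancelʳ-≤ r cG c (≤-trans (+-monoʳ-≤ cG r≤cH) (≤-reflexive (sym eq)))))
⊓-≤-of-crossing {a} {b} {r} {c} eq a≤cG b≤cH a≤r (inj₂ (inj₂ r+r≤)) =
  ≤-trans (m⊓n≤m a b) (≤-trans a≤r (+-cancelʳ-≤ r r c (≤-trans r+r≤ (≤-reflexive (sym eq)))))

module Glue {n m : ℕ} (r t : ℕ) (μG : Mult n) (μH : Mult (suc (suc m)))
  (u v : Fin n) (x y : Fin (suc (suc m))) (u≢v : u ≢ v) (x≢y : x ≢ y) where

  μ′ : Mult (n + m)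
  μ′ = glue r t μG u v μH x y x≢y

  Gd : Mult n
  Gd = deleteEdges μG u v t

  Hd : Mult (suc (suc m))
  Hd = deleteEdges μH x y (r ∸ t)

  fG : Fin (n + m) → Maybe (Fin n)
  fG = glueG {n} m

  fH : Fin (n + m) → Maybe (Fin (suc (suc m)))
  fH = glueH u v x y x≢y

  ιG : Fin n → Fin (n + m)
  ιG g = g ↑ˡ m

  ιR : Fin m → Fin (n + m)
  ιR k = n ↑ʳ k

  -- π enumerates the vertices of H other than x and y, in the order used by glueH.
  π : Fin m → Fin (suc (suc m))
  π k = punchIn x (punchIn (punchOut x≢y) k)

  π≢x : ∀ k → π k ≢ x
  π≢x k = punchInᵢ≢i x _

  π≢y : ∀ k → π k ≢ y
  π≢y k e = punchInᵢ≢i (punchOut x≢y) k (punchIn-injective x _ _ (trans e (sym (punchIn-punchOut x≢y))))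

  π-injective : ∀ k k′ → π k ≡ π k′ → k ≡ k′
  π-injective k k′ e = punchIn-injective (punchOut x≢y) k k′ (punchIn-injective x _ _ e)

  data HView (h : Fin (suc (suc m))) : Set where
    at-x : h ≡ x → HView h
    at-y : h ≡ y → HView h
    at-π : ∀ k → h ≡ π k → HView h

  hView : ∀ h → HView h
  hView h with h ≟ x
  ... | yes h≡x = at-x h≡x
  ... | no  h≢x with punchOut (h≢x ∘ sym) ≟ punchOut x≢y
  ...   | yes e = at-y (trans (sym (punchIn-punchOut (h≢x ∘ sym)))
                              (trans (cong (punchIn x) e) (punchIn-punchOut x≢y)))
  ...   | no  ne = at-π (punchOut (ne ∘ sym))
                        (trans (sym (punchIn-punchOut (h≢x ∘ sym)))
                               (cong (punchIn x) (sym (punchIn-punchOut (ne ∘ sym)))))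

  ιH : Fin (suc (suc m)) → Fin (n + m)
  ιH h with hView h
  ... | at-x _   = ιG u
  ... | at-y _   = ιG v
  ... | at-π k _ = ιR k

  ιH-x : ιH x ≡ ιG u
  ιH-x with hView x
  ... | at-x _   = refl
  ... | at-y x≡y = ⊥-elim (x≢y x≡y)
  ... | at-π k e = ⊥-elim (π≢x k (sym e))

  ιH-y : ιH y ≡ ιG v
  ιH-y with hView y
  ... | at-x y≡x = ⊥-elim (x≢y (sym y≡x))
  ... | at-y _   = refl
  ... | at-π k e = ⊥-elim (π≢y k (sym e))

  ιH-π : ∀ k → ιH (π k) ≡ ιR k
  ιH-π k with hView (π k)
  ... | at-x e    = ⊥-elim (π≢x k e)
  ... | at-y e    = ⊥-elim (π≢y k e)
  ... | at-π k′ e = cong ιR (π-injective k′ k (sym e))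

  ≗∘ιH : ∀ {A : Set} (Φ : Fin (suc (suc m)) → A) (F : Fin (n + m) → A) →
         Φ x ≡ F (ιG u) → Φ y ≡ F (ιG v) → (∀ k → Φ (π k) ≡ F (ιR k)) → Φ ≗ F ∘ ιH
  ≗∘ιH Φ F Φx Φy Φπ h with hView h
  ... | at-x refl   = Φx
  ... | at-y refl   = Φy
  ... | at-π k refl = Φπ k

  fG-ιG : ∀ g → fG (ιG g) ≡ just g
  fG-ιG g rewrite splitAt-↑ˡ n g m = refl

  fG-ιR : ∀ k → fG (ιR k) ≡ nothing
  fG-ιR k rewrite splitAt-↑ʳ n m k = refl

  fH-ιH : ∀ h → fH (ιH h) ≡ just h
  fH-ιH h with hView h
  ... | at-x refl   rewrite splitAt-↑ˡ n u m | is-refl u = refl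
  ... | at-y refl   rewrite splitAt-↑ˡ n v m | is-≢ (u≢v ∘ sym) | is-refl v = refl
  ... | at-π k refl rewrite splitAt-↑ʳ n m k = refl

  fH-ιG : ∀ g → g ≢ u → g ≢ v → fH (ιG g) ≡ nothing
  fH-ιG g g≢u g≢v rewrite splitAt-↑ˡ n g m | is-≢ g≢u | is-≢ g≢v = refl

  sumFin-H : ∀ (Φ : Fin (suc (suc m)) → ℕ) → sumFin Φ ≡ (Φ x + Φ y) + sumFin (Φ ∘ π)
  sumFin-H Φ = begin
    sumFin Φ
      ≡⟨ sumFin-punchIn Φ x ⟩
    Φ x + sumFin (Φ ∘ punchIn x)
      ≡⟨ cong (Φ x +_) (sumFin-punchIn (Φ ∘ punchIn x) (punchOut x≢y)) ⟩
    Φ x + (Φ (punchIn x (punchOut x≢y)) + sumFin (Φ ∘ π))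
      ≡⟨ cong (λ h → Φ x + (Φ h + sumFin (Φ ∘ π))) (punchIn-punchOut x≢y) ⟩
    Φ x + (Φ y + sumFin (Φ ∘ π))
      ≡⟨ +-assoc (Φ x) _ _ ⟨
    (Φ x + Φ y) + sumFin (Φ ∘ π) ∎
    where open ≡-Reasoning

  reindex-G : ∀ F → (∀ a → fG a ≡ nothing → F a ≡ 0) → sumFin F ≡ sumFin (F ∘ ιG)
  reindex-G F F≡0 = begin
    sumFin F                                   ≡⟨ sumFin-↑ n F ⟩
    sumFin (F ∘ ιG) + sumFin (F ∘ ιR)          ≡⟨ cong (sumFin (F ∘ ιG) +_) (sumFin-0 (λ k → F≡0 _ (fG-ιR k))) ⟩
    sumFin (F ∘ ιG) + 0                        ≡⟨ +-identityʳ _ ⟩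
    sumFin (F ∘ ιG)                            ∎
    where open ≡-Reasoning

  reindex-H : ∀ F → (∀ a → fH a ≡ nothing → F a ≡ 0) → sumFin F ≡ sumFin (F ∘ ιH)
  reindex-H F F≡0 = begin
    sumFin F
      ≡⟨ sumFin-↑ n F ⟩
    sumFin (F ∘ ιG) + sumFin (F ∘ ιR)
      ≡⟨ cong (_+ sumFin (F ∘ ιR)) (sumFin-pair (F ∘ ιG) u≢v (λ g g≢u g≢v → F≡0 _ (fH-ιG g g≢u g≢v))) ⟩
    (F (ιG u) + F (ιG v)) + sumFin (F ∘ ιR)
      ≡⟨ cong₂ (λ a b → (F a + F b) + sumFin (F ∘ ιR)) ιH-x ιH-y ⟨
    (F (ιH x) + F (ιH y)) + sumFin (F ∘ ιR)
      ≡⟨ cong ((F (ιH x) + F (ιH y)) +_) (sumFin-cong (cong F ∘ ιH-π)) ⟨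
    (F (ιH x) + F (ιH y)) + sumFin (F ∘ ιH ∘ π)
      ≡⟨ sumFin-H (F ∘ ιH) ⟨
    sumFin (F ∘ ιH) ∎
    where open ≡-Reasoning

  ∂-glue : ∀ S → ∂ μ′ S ≡ ∂ Gd (S ∘ ιG) + ∂ Hd (S ∘ ιH)
  ∂-glue S = trans (∂-+ (liftMult Gd fG) (liftMult Hd fH) S)
                   (cong₂ _+_ (∂-liftMult Gd fG ιG fG-ιG reindex-G S) (∂-liftMult Hd fH ιH fH-ιH reindex-H S))

  count-glue : ∀ S → count S + ([ S (ιG u) ]· 1 + [ S (ιG v) ]· 1) ≡ count (S ∘ ιG) + count (S ∘ ιH)
  count-glue S = begin
    count S + (Su + Sv)                          ≡⟨ cong (_+ (Su + Sv)) (sumFin-↑ n (λ a → [ S a ]· 1)) ⟩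
    (count (S ∘ ιG) + count (S ∘ ιR)) + (Su + Sv) ≡⟨ +-assoc (count (S ∘ ιG)) _ _ ⟩
    count (S ∘ ιG) + (count (S ∘ ιR) + (Su + Sv)) ≡⟨ cong (count (S ∘ ιG) +_) (+-comm _ (Su + Sv)) ⟩
    count (S ∘ ιG) + ((Su + Sv) + count (S ∘ ιR)) ≡⟨ cong (count (S ∘ ιG) +_) count-H ⟨
    count (S ∘ ιG) + count (S ∘ ιH)               ∎
    where
    open ≡-Reasoning
    Su = [ S (ιG u) ]· 1
    Sv = [ S (ιG v) ]· 1
    count-H : count (S ∘ ιH) ≡ (Su + Sv) + count (S ∘ ιR)
    count-H = trans (sumFin-H (λ h → [ S (ιH h) ]· 1))
                    (cong₂ _+_ (cong₂ (λ a b → [ S a ]· 1 + [ S b ]· 1) ιH-x ιH-y)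
                               (sumFin-cong (λ k → cong (λ a → [ S a ]· 1) (ιH-π k))))

  glue-isMultigraph : IsMultigraph μG → IsMultigraph μH → IsMultigraph μ′
  glue-isMultigraph (symG , looplessG) (symH , looplessH) =
    (λ a b → cong₂ _+_ (liftMult-sym Gd fG (deleteEdges-sym μG u v t symG) a b)
                       (liftMult-sym Hd fH (deleteEdges-sym μH x y (r ∸ t) symH) a b)) ,
    (λ a → cong₂ _+_ (liftMult-loopless Gd fG (deleteEdges-loopless μG u v t looplessG) a)
                     (liftMult-loopless Hd fH (deleteEdges-loopless μH x y (r ∸ t) looplessH) a))

module GluedRGraphs {n m : ℕ} (r t : ℕ) (μG : Mult n) (μH : Mult (suc (suc m)))
  (u v : Fin n) (x y : Fin (suc (suc m))) (u≢v : u ≢ v) (x≢y : x ≢ y)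
  (rgG : IsRGraph r μG) (rgH : IsRGraph r μH) (t≤μuv : t ≤ μG u v) (r∸t≤μxy : r ∸ t ≤ μH x y) where

  open Glue r t μG μH u v x y u≢v x≢y

  symG : ∀ a b → μG a b ≡ μG b a
  symG = proj₁ (proj₁ rgG)

  symH : ∀ a b → μH a b ≡ μH b a
  symH = proj₁ (proj₁ rgH)

  looplessG : ∀ a → μG a a ≡ 0
  looplessG = proj₂ (proj₁ rgG)

  looplessH : ∀ a → μH a a ≡ 0
  looplessH = proj₂ (proj₁ rgH)

  regularG : Regular r μG
  regularG = proj₁ (proj₂ rgG)

  regularH : Regular r μH
  regularH = proj₁ (proj₂ rgH)

  multigraph′ : IsMultigraph μ′
  multigraph′ = glue-isMultigraph (proj₁ rgG) (proj₁ rgH)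

  t≤r : t ≤ r
  t≤r = ≤-trans t≤μuv (subst (μG u v ≤_) (regularG u) (sumFin-≥ (μG u) v))

  ∂-glued : ∀ S SG SH → SG ≗ S ∘ ιG → SH ≗ S ∘ ιH →
            ∂ μ′ S + [ SG u xor SG v ]· r ≡ ∂ μG SG + ∂ μH SH
  ∂-glued S SG SH SG≗ SH≗ = begin
    ∂ μ′ S + [ δ ]· r
      ≡⟨ cong₂ _+_ (trans (∂-glue S) (cong₂ _+_ (∂-cong Gd (sym ∘ SG≗)) (∂-cong Hd (sym ∘ SH≗))))
                   (cong ([ δ ]·_) (sym (m+[n∸m]≡n t≤r))) ⟩
    (∂ Gd SG + ∂ Hd SH) + [ δ ]· (t + (r ∸ t))
      ≡⟨ cong ((∂ Gd SG + ∂ Hd SH) +_) ([]·-+ δ t (r ∸ t)) ⟩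
    (∂ Gd SG + ∂ Hd SH) + ([ δ ]· t + [ δ ]· (r ∸ t))
      ≡⟨ interchange (∂ Gd SG) (∂ Hd SH) ([ δ ]· t) ([ δ ]· (r ∸ t)) ⟩
    (∂ Gd SG + [ δ ]· t) + (∂ Hd SH + [ δ ]· (r ∸ t))
      ≡⟨ cong (λ c → (∂ Gd SG + [ δ ]· t) + (∂ Hd SH + [ c ]· (r ∸ t))) δH≡δ ⟨
    (∂ Gd SG + [ δ ]· t) + (∂ Hd SH + [ SH x xor SH y ]· (r ∸ t))
      ≡⟨ cong₂ _+_ (∂-deleteEdges μG t SG symG u≢v t≤μuv) (∂-deleteEdges μH (r ∸ t) SH symH x≢y r∸t≤μxy) ⟨
    ∂ μG SG + ∂ μH SH ∎
    where
    open ≡-Reasoning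
    δ = SG u xor SG v
    δH≡δ : SH x xor SH y ≡ δ
    δH≡δ = cong₂ _xor_ (trans (SH≗ x) (trans (cong S ιH-x) (sym (SG≗ u))))
                       (trans (SH≗ y) (trans (cong S ιH-y) (sym (SG≗ v))))

  glue-regular : Regular r μ′
  glue-regular a = trans (sym (∂-is μ′ a (proj₂ multigraph′ a))) (∂-vertex (splitView n a))
    where
    ∂-vertex : ∀ {a} → SplitView n m a → ∂ μ′ (is a) ≡ r
    ∂-vertex (left g) = +-cancelʳ-≡ _ _ _ (begin
      ∂ μ′ (is (ιG g)) + [ is g u xor is g v ]· r
        ≡⟨ ∂-glued (is (ιG g)) (is g) SH G-agrees H-agrees ⟩
      ∂ μG (is g) + ∂ μH SH
        ≡⟨ cong₂ _+_ (trans (∂-is μG g (looplessG g)) (regularG g))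
                     (∂-pinned μH looplessH regularH x y (is g u) (is g v)) ⟩
      r + [ is g u xor is g v ]· r ∎)
      where
      open ≡-Reasoning
      SH = pinned x y (is g u) (is g v)
      ιG-is : ∀ g′ → is (ιG g) (ιG g′) ≡ is g g′
      ιG-is = is-injective ιG (↑ˡ-injective m) g
      G-agrees : is g ≗ is (ιG g) ∘ ιG
      G-agrees g′ = sym (ιG-is g′)
      H-agrees : SH ≗ is (ιG g) ∘ ιH
      H-agrees = ≗∘ιH SH (is (ιG g))
        (trans (pinned-first (is g u) (is g v) x≢y) (sym (ιG-is u)))
        (trans (pinned-second (is g u) (is g v) x≢y) (sym (ιG-is v)))
        (λ k → trans (pinned-other (is g u) (is g v) (π≢x k) (π≢y k))
                     (trans (trans (cong₂ _∧_ (is-comm g u) (is-comm g v)) (is-disjoint u≢v g))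
                            (sym (is-≢ (↑ˡ≢↑ʳ n g k ∘ sym)))))
    ∂-vertex (right k) = begin
      ∂ μ′ (is (ιR k))
        ≡⟨ +-identityʳ _ ⟨
      ∂ μ′ (is (ιR k)) + 0
        ≡⟨ ∂-glued (is (ιR k)) (const false) (is (π k)) G-agrees H-agrees ⟩
      ∂ μG (const false) + ∂ μH (is (π k))
        ≡⟨ cong₂ _+_ (∂-const μG false) (trans (∂-is μH (π k) (looplessH (π k))) (regularH (π k))) ⟩
      r ∎
      where
      open ≡-Reasoning
      G-agrees : const false ≗ is (ιR k) ∘ ιG
      G-agrees g = sym (is-≢ (↑ˡ≢↑ʳ n g k))
      H-agrees : is (π k) ≗ is (ιR k) ∘ ιH
      H-agrees = ≗∘ιH (is (π k)) (is (ιR k))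
        (trans (is-≢ (π≢x k ∘ sym)) (sym (is-≢ (↑ˡ≢↑ʳ n u k))))
        (trans (is-≢ (π≢y k ∘ sym)) (sym (is-≢ (↑ˡ≢↑ʳ n v k))))
        (λ k′ → trans (is-injective π π-injective k k′) (sym (is-injective ιR (↑ʳ-injective n) k k′)))

  r+r≤ : ∀ {A B} → t ≤ A → r ∸ t ≤ B → r + r ≤ (A + A) + (B + B)
  r+r≤ {A} {B} t≤A r∸t≤B = begin
    r + r                          ≡⟨ cong₂ _+_ (m+[n∸m]≡n t≤r) (m+[n∸m]≡n t≤r) ⟨
    (t + (r ∸ t)) + (t + (r ∸ t))  ≡⟨ interchange t (r ∸ t) t (r ∸ t) ⟩
    (t + t) + ((r ∸ t) + (r ∸ t))  ≤⟨ +-mono-≤ (+-mono-≤ t≤A t≤A) (+-mono-≤ r∸t≤B r∸t≤B) ⟩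
    (A + A) + (B + B)              ∎
    where open ≤-Reasoning

  -- By ∂-even-≥ the two cuts contain at least 2t and 2(r ∸ t) edges.
  ∂-crossing-even : ∀ SG SH → SH x ≡ SG u → SH y ≡ SG v → SG u xor SG v ≡ true →
                    odd (count SG) ≡ false → odd (count SH) ≡ false → r + r ≤ ∂ μG SG + ∂ μH SH
  ∂-crossing-even SG SH SHx SHy δ evenG evenH = crossing (SG u) (SG v) refl refl δ
    where
    crossing : ∀ a b → SG u ≡ a → SG v ≡ b → a xor b ≡ true → r + r ≤ ∂ μG SG + ∂ μH SH
    crossing true  false SGu SGv _ =
      ≤-trans (r+r≤ (subst (t ≤_) (symG u v) t≤μuv) (subst (r ∸ t ≤_) (symH x y) r∸t≤μxy))
              (+-mono-≤ (∂-even-≥ rgG SG SGu SGv evenG) (∂-even-≥ rgH SH (trans SHx SGu) (trans SHy SGv) evenH))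
    crossing false true  SGu SGv _ =
      ≤-trans (r+r≤ t≤μuv r∸t≤μxy)
              (+-mono-≤ (∂-even-≥ rgG SG SGv SGu evenG) (∂-even-≥ rgH SH (trans SHy SGv) (trans SHx SGu) evenH))

  ∂-crossing-≥ : ∀ SG SH → SH x ≡ SG u → SH y ≡ SG v → SG u xor SG v ≡ true →
                 r ≤ ∂ μG SG ⊎ r ≤ ∂ μH SH ⊎ r + r ≤ ∂ μG SG + ∂ μH SH
  ∂-crossing-≥ SG SH SHx SHy δ with odd (count SG) in oddG | odd (count SH) in oddH
  ... | true  | _     = inj₁ (∂-odd-≥ rgG SG oddG)
  ... | false | true  = inj₂ (inj₁ (∂-odd-≥ rgH SH oddH))
  ... | false | false = inj₂ (inj₂ (∂-crossing-even SG SH SHx SHy δ oddG oddH))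

  glue-odd-∂-≥ : ∀ S → odd (count S) ≡ true → r ≤ ∂ μ′ S
  glue-odd-∂-≥ S oddS = by-parity _ _ _ refl refl refl
    where
    SG = S ∘ ιG
    SH = S ∘ ιH
    cut≡ : ∀ {c} → S (ιG u) xor S (ιG v) ≡ c → ∂ μG SG + ∂ μH SH ≡ ∂ μ′ S + [ c ]· r
    cut≡ refl = sym (∂-glued S SG SH (λ _ → refl) (λ _ → refl))
    parity : ∀ {c} → S (ιG u) xor S (ιG v) ≡ c → odd (count SG) xor odd (count SH) ≡ not c
    parity refl = begin
      odd (count SG) xor odd (count SH)        ≡⟨ odd-+ (count SG) (count SH) ⟨
      odd (count SG + count SH)                ≡⟨ cong odd (count-glue S) ⟨
      odd (count S + ([ S (ιG u) ]· 1 + [ S (ιG v) ]· 1))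
                                               ≡⟨ odd-+ (count S) _ ⟩
      odd (count S) xor odd ([ S (ιG u) ]· 1 + [ S (ιG v) ]· 1)
                                               ≡⟨ cong₂ _xor_ oddS (odd-[]·1+[]·1 (S (ιG u)) (S (ιG v))) ⟩
      not (S (ιG u) xor S (ιG v))              ∎
      where open ≡-Reasoning
    by-parity : ∀ c pG pH → S (ιG u) xor S (ιG v) ≡ c → odd (count SG) ≡ pG → odd (count SH) ≡ pH →
                r ≤ ∂ μ′ S
    by-parity false true  _     δ oddG oddH =
      ≤-trans (∂-odd-≥ rgG SG oddG) (≤-trans (m≤m+n _ _) (≤-reflexive (trans (cut≡ δ) (+-identityʳ _))))
    by-parity false false true  δ oddG oddH =
      ≤-trans (∂-odd-≥ rgH SH oddH)
              (≤-trans (m≤n+m (∂ μH SH) (∂ μG SG)) (≤-reflexive (trans (cut≡ δ) (+-identityʳ _))))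
    by-parity true  true  true  δ oddG oddH =
      +-cancelʳ-≤ r r _ (≤-trans (+-mono-≤ (∂-odd-≥ rgG SG oddG) (∂-odd-≥ rgH SH oddH)) (≤-reflexive (cut≡ δ)))
    by-parity true  false false δ oddG oddH =
      +-cancelʳ-≤ r r _ (≤-trans (∂-crossing-even SG SH (cong S ιH-x) (cong S ιH-y) δ oddG oddH) (≤-reflexive (cut≡ δ)))
    by-parity false false false δ oddG oddH with () ← trans (sym (parity δ)) (cong₂ _xor_ oddG oddH)
    by-parity true  true  false δ oddG oddH with () ← trans (sym (parity δ)) (cong₂ _xor_ oddG oddH)
    by-parity true  false true  δ oddG oddH with () ← trans (sym (parity δ)) (cong₂ _xor_ oddG oddH)

  extendG : (Fin n → Bool) → Fin (n + m) → Bool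
  extendG SX = SX ++ const (SX u ∧ SX v)

  extendH : (Fin (suc (suc m)) → Bool) → Fin (n + m) → Bool
  extendH SX = pinned u v (SX x) (SX y) ++ SX ∘ π

  extendG-ιG : ∀ SX → SX ≗ extendG SX ∘ ιG
  extendG-ιG SX g = sym (lookup-++ˡ SX _ g)

  extendH-ιG : ∀ SX → pinned u v (SX x) (SX y) ≗ extendH SX ∘ ιG
  extendH-ιG SX g = sym (lookup-++ˡ (pinned u v (SX x) (SX y)) _ g)

  extendH-ιH : ∀ SX → SX ≗ extendH SX ∘ ιH
  extendH-ιH SX = ≗∘ιH SX (extendH SX)
    (trans (sym (pinned-first (SX x) (SX y) u≢v)) (extendH-ιG SX u))
    (trans (sym (pinned-second (SX x) (SX y) u≢v)) (extendH-ιG SX v))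
    (λ k → sym (lookup-++ʳ (pinned u v (SX x) (SX y)) _ k))

  ∂-extendG : ∀ SX → ∂ μ′ (extendG SX) ≡ ∂ μG SX
  ∂-extendG SX = +-cancelʳ-≡ _ _ _ (begin
    ∂ μ′ (extendG SX) + [ SX u xor SX v ]· r ≡⟨ ∂-glued (extendG SX) SX SH (extendG-ιG SX) H-agrees ⟩
    ∂ μG SX + ∂ μH SH                       ≡⟨ cong (∂ μG SX +_) (∂-pinned μH looplessH regularH x y (SX u) (SX v)) ⟩
    ∂ μG SX + [ SX u xor SX v ]· r          ∎)
    where
    open ≡-Reasoning
    SH = pinned x y (SX u) (SX v)
    H-agrees : SH ≗ extendG SX ∘ ιH
    H-agrees = ≗∘ιH SH (extendG SX)
      (trans (pinned-first (SX u) (SX v) x≢y) (extendG-ιG SX u))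
      (trans (pinned-second (SX u) (SX v) x≢y) (extendG-ιG SX v))
      (λ k → trans (pinned-other (SX u) (SX v) (π≢x k) (π≢y k)) (sym (lookup-++ʳ SX _ k)))

  ∂-extendH : ∀ SX → ∂ μ′ (extendH SX) ≡ ∂ μH SX
  ∂-extendH SX = +-cancelʳ-≡ _ _ _ (begin
    ∂ μ′ (extendH SX) + [ SX x xor SX y ]· r ≡⟨ cong (λ c → ∂ μ′ (extendH SX) + [ c ]· r) δ≡ ⟨
    ∂ μ′ (extendH SX) + [ SG u xor SG v ]· r ≡⟨ ∂-glued (extendH SX) SG SX (extendH-ιG SX) (extendH-ιH SX) ⟩
    ∂ μG SG + ∂ μH SX                        ≡⟨ cong (_+ ∂ μH SX) (∂-pinned μG looplessG regularG u v (SX x) (SX y)) ⟩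
    [ SX x xor SX y ]· r + ∂ μH SX           ≡⟨ +-comm _ (∂ μH SX) ⟩
    ∂ μH SX + [ SX x xor SX y ]· r           ∎)
    where
    open ≡-Reasoning
    SG = pinned u v (SX x) (SX y)
    δ≡ : SG u xor SG v ≡ SX x xor SX y
    δ≡ = cong₂ _xor_ (pinned-first (SX x) (SX y) u≢v) (pinned-second (SX x) (SX y) u≢v)

  cuts-restrictG : ∀ {k} → CutsAtLeast μ′ k → CutsAtLeast μG k
  cuts-restrictG {k} cuts′ = ∂-≥⇒CutsAtLeast {μ = μG} λ SX {i} {j} Si Sj →
    subst (k ≤_) (∂-extendG SX)
      (CutsAtLeast⇒∂-≥ cuts′ (extendG SX) (trans (sym (extendG-ιG SX i)) Si) (trans (sym (extendG-ιG SX j)) Sj))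

  cuts-restrictH : ∀ {k} → CutsAtLeast μ′ k → CutsAtLeast μH k
  cuts-restrictH {k} cuts′ = ∂-≥⇒CutsAtLeast {μ = μH} λ SX {i} {j} Si Sj →
    subst (k ≤_) (∂-extendH SX)
      (CutsAtLeast⇒∂-≥ cuts′ (extendH SX) (trans (sym (extendH-ιH SX i)) Si) (trans (sym (extendH-ιH SX j)) Sj))

  glue-cuts-≥ : ∀ {a b} → CutsAtLeast μG a → CutsAtLeast μH b → CutsAtLeast μ′ (a ⊓ b)
  glue-cuts-≥ {a} {b} cutsG cutsH = ∂-≥⇒CutsAtLeast {μ = μ′} bound
    where
    a≤r : a ≤ r
    a≤r = subst (a ≤_) (regularG u) (CutsAtLeast⇒≤degree cutsG (looplessG u) u≢v)
    bound : ∀ S {i j} → S i ≡ true → S j ≡ false → a ⊓ b ≤ ∂ μ′ S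
    bound S Si Sj = by-crossing _ refl
      where
      SG = S ∘ ιG
      SH = S ∘ ιH
      cut≡ : ∀ {c} → S (ιG u) xor S (ιG v) ≡ c → ∂ μ′ S + [ c ]· r ≡ ∂ μG SG + ∂ μH SH
      cut≡ refl = ∂-glued S SG SH (λ _ → refl) (λ _ → refl)
      on-one-side : ∀ {z} → SplitView n m z → S (ιG u) xor S (ιG v) ≡ false → S z ≢ S (ιG u) → a ⊓ b ≤ ∂ μ′ S
      on-one-side (left g) δ Sg≢Su =
        ≤-trans (m⊓n≤m a b) (≤-trans (CutsAtLeast⇒∂-separating-≥ {μ = μG} cutsG SG {g} {u} Sg≢Su)
          (≤-trans (m≤m+n _ _) (≤-reflexive (trans (sym (cut≡ δ)) (+-identityʳ _)))))
      on-one-side (right k) δ Sk≢Su =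
        ≤-trans (m⊓n≤n a b) (≤-trans (CutsAtLeast⇒∂-separating-≥ {μ = μH} cutsH SH {π k} {x} SHk≢SHx)
          (≤-trans (m≤n+m (∂ μH SH) (∂ μG SG)) (≤-reflexive (trans (sym (cut≡ δ)) (+-identityʳ _)))))
        where
        SHk≢SHx : SH (π k) ≢ SH x
        SHk≢SHx e = Sk≢Su (trans (sym (cong S (ιH-π k))) (trans e (cong S ιH-x)))
      by-crossing : ∀ c → S (ιG u) xor S (ιG v) ≡ c → a ⊓ b ≤ ∂ μ′ S
      by-crossing true  δ =
        ⊓-≤-of-crossing (cut≡ δ) (CutsAtLeast⇒∂-separating-≥ {μ = μG} cutsG SG {u} {v} (xor≡true⇒≢ δ))
          (CutsAtLeast⇒∂-separating-≥ {μ = μH} cutsH SH {x} {y}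
            (xor≡true⇒≢ (trans (cong₂ _xor_ (cong S ιH-x) (cong S ιH-y)) δ)))
          a≤r (∂-crossing-≥ SG SH (cong S ιH-x) (cong S ιH-y) δ)
      by-crossing false δ with other-side S Si Sj (ιG u)
      ... | z , Sz≢Su = on-one-side (splitView n z) δ Sz≢Su

  glue-isRGraph : IsRGraph r μ′
  glue-isRGraph = odd-∂-≥⇒IsRGraph multigraph′ glue-regular glue-odd-∂-≥

  glue-edgeConnectivity : ∀ a b → IsEdgeConnectivity μG a → IsEdgeConnectivity μH b →
                          IsEdgeConnectivity μ′ (a ⊓ b)
  glue-edgeConnectivity a b (cutsG , maxG) (cutsH , maxH) =
    glue-cuts-≥ cutsG cutsH ,
    λ k cuts′ → ⊓-glb (maxG k (cuts-restrictG cuts′)) (maxH k (cuts-restrictH cuts′))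

lemma2p5 : ∀ {n m} (r t : ℕ) (μG : Mult n) (μH : Mult (suc (suc m)))
    (u v : Fin n) (x y : Fin (suc (suc m))) (u≢v : u ≢ v) (x≢y : x ≢ y) →
    IsRGraph r μG → IsRGraph r μH →
    t ≤ μG u v → r ∸ t ≤ μH x y →
    IsRGraph r (glue r t μG u v μH x y x≢y)
    × (∀ a b → IsEdgeConnectivity μG a → IsEdgeConnectivity μH b →
         IsEdgeConnectivity (glue r t μG u v μH x y x≢y) (a ⊓ b))
lemma2p5 r t μG μH u v x y u≢v x≢y rgG rgH t≤μuv r∸t≤μxy = glue-isRGraph , glue-edgeConnectivity
  where open GluedRGraphs r t μG μH u v x y u≢v x≢y rgG rgH t≤μuv r∸t≤μxy
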